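{- Let $\pi,\sigma\in S_n$ with $\pi=q(\sigma)$. Then every (value that is an) LTR maximum of $\sigma$ is also an LTR maximum of $\pi$.
   Context: $S_n$ is the set of permutations of $\{1,\dots,n\}$ in one-line notation. An entry $\pi_i$ is a left-to-right (LTR) maximum if $\pi_i>\pi_j$ for all $j<i$. The map $q:S_n\to S_n$ (the algorithm Queuesort, sorting with a queue allowing bypass): let $m_1,\dots,m_r$ be the LTR maxima of $\pi$ from left to right; for $i=r,\dots,1$ in this order, repeatedly swap $m_i$ with the entry immediately to its right as long as such an entry exists and is smaller than $m_i$; the result is $q(\pi)$. -}

module Defs where

open import Data.Nat using (ℕ; zero; suc; _<_; _<ᵇ_; _≡ᵇ_)
open import Data.Bool using (Bool; true; false; if_then_else_)
open import Data.List using (List; []; _∷_; reverse; length; lookup; map)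
open import Data.List.Relation.Unary.All using (All)
open import Data.List.Relation.Binary.Permutation.Propositional using (_↭_)
open import Data.List.Membership.Propositional using (_∈_)
open import Data.Fin using (Fin; toℕ)
open import Data.Product using (Σ; ∃; _×_; _,_)
open import Relation.Binary.PropositionalEquality using (_≡_)

oneTo : ℕ → List ℕ
oneTo n = go n []
  where
  go : ℕ → List ℕ → List ℕ
  go zero acc = acc
  go (suc k) acc = go k (suc k ∷ acc)

-- a permutation of {1,...,n} in one-line notation
IsPerm : ℕ → List ℕ → Set
IsPerm n π = π ↭ oneTo n

IsLTRMaxAt : (π : List ℕ) → Fin (length π) → Set
IsLTRMaxAt π i = ∀ (j : Fin (length π)) → toℕ j < toℕ i → lookup π j < lookup π i

IsLTRMaxValue : List ℕ → ℕ → Set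
IsLTRMaxValue π v = Σ (Fin (length π)) λ i → (lookup π i ≡ v) × IsLTRMaxAt π i

ltrMaxima : List ℕ → List ℕ
ltrMaxima = go 0
  where
  go : ℕ → List ℕ → List ℕ
  go m [] = []
  go m (x ∷ xs) = if m <ᵇ x then x ∷ go x xs else go m xs

bubble : ℕ → List ℕ → List ℕ
bubble m [] = m ∷ []
bubble m (y ∷ ys) = if y <ᵇ m then y ∷ bubble m ys else m ∷ y ∷ ys

moveRight : ℕ → List ℕ → List ℕ
moveRight m [] = []
moveRight m (x ∷ xs) = if x ≡ᵇ m then bubble m xs else x ∷ moveRight m xs

moveAll : List ℕ → List ℕ → List ℕ
moveAll [] π = π
moveAll (m ∷ ms) π = moveAll ms (moveRight m π)

-- Queuesort: process LTR maxima m_r, ..., m_1 (right to left)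
q : List ℕ → List ℕ
q σ = moveAll (reverse (ltrMaxima σ)) σ

module Submission where

-- Bubbling an entry m to the right only carries it past entries smaller than m.
-- So it stops before any larger left-to-right maximum v, and it never changes
-- what lies before v when it starts to the right of v; if m = v itself, v is
-- still larger than everything it passed. Hence every single move of Queuesort,
-- and so any sequence of moves, keeps each left-to-right maximum one.

open import Defs
open import Data.Nat using (ℕ; _<_; _<ᵇ_; _≡ᵇ_; z<s; s<s)
open import Data.Nat.Properties using (<ᵇ-reflects-<; ≡ᵇ⇒≡; ≡⇒≡ᵇ; <-asym)
open import Data.Bool using (true; false)
open import Data.List using (List; []; _∷_; reverse)
open import Data.Fin using () renaming (zero to fzero; suc to fsuc)
open import Data.Product using (_,_)
open import Relation.Nullary.Negation using (contradiction)
open import Relation.Nullary.Reflects using (Reflects; ofʸ; ofⁿ; fromEquivalence)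
open import Relation.Binary.PropositionalEquality using (_≡_; refl)

data LTRMax (v : ℕ) : List ℕ → Set where
  here  : ∀ {xs} → LTRMax v (v ∷ xs)
  there : ∀ {x xs} → x < v → LTRMax v xs → LTRMax v (x ∷ xs)

IsLTRMaxValue⇒LTRMax : ∀ xs {v} → IsLTRMaxValue xs v → LTRMax v xs
IsLTRMaxValue⇒LTRMax (x ∷ xs) (fzero , refl , _) = here
IsLTRMaxValue⇒LTRMax (x ∷ xs) (fsuc i , refl , maxAt) =
  there (maxAt fzero z<s)
        (IsLTRMaxValue⇒LTRMax xs (i , refl , λ j j<i → maxAt (fsuc j) (s<s j<i)))

LTRMax⇒IsLTRMaxValue : ∀ {xs v} → LTRMax v xs → IsLTRMaxValue xs v
LTRMax⇒IsLTRMaxValue here = fzero , refl , λ _ ()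
LTRMax⇒IsLTRMaxValue {x ∷ xs} (there x<v p) with LTRMax⇒IsLTRMaxValue p
... | i , refl , maxAt = fsuc i , refl , maxAtSuc
  where
  maxAtSuc : IsLTRMaxAt (x ∷ xs) (fsuc i)
  maxAtSuc fzero    _         = x<v
  maxAtSuc (fsuc j) (s<s j<i) = maxAt j j<i

≡ᵇ-reflects-≡ : ∀ m n → Reflects (m ≡ n) (m ≡ᵇ n)
≡ᵇ-reflects-≡ m n = fromEquivalence (≡ᵇ⇒≡ m n) (≡⇒≡ᵇ m n)

bubble-LTRMax-self : ∀ m xs → LTRMax m (bubble m xs)
bubble-LTRMax-self m [] = here
bubble-LTRMax-self m (y ∷ ys) with y <ᵇ m | <ᵇ-reflects-< y m
... | true  | ofʸ y<m = there y<m (bubble-LTRMax-self m ys)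
... | false | ofⁿ _   = here

bubble-preserves-LTRMax : ∀ {m v} xs → m < v → LTRMax v xs → LTRMax v (bubble m xs)
bubble-preserves-LTRMax {m} {v} (y ∷ ys) m<v p with y <ᵇ m | <ᵇ-reflects-< y m | p
... | true  | ofʸ v<m | here          = contradiction v<m (<-asym m<v)
... | true  | ofʸ _   | there y<v p′  = there y<v (bubble-preserves-LTRMax ys m<v p′)
... | false | ofⁿ _   | _             = there m<v p

moveRight-preserves-LTRMax : ∀ m {v} xs → LTRMax v xs → LTRMax v (moveRight m xs)
moveRight-preserves-LTRMax m (x ∷ xs) p with x ≡ᵇ m | ≡ᵇ-reflects-≡ x m | p
... | true  | ofʸ refl | here         = bubble-LTRMax-self m xs
... | true  | ofʸ refl | there m<v p′ = bubble-preserves-LTRMax xs m<v p′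
... | false | ofⁿ _    | here         = here
... | false | ofⁿ _    | there x<v p′ = there x<v (moveRight-preserves-LTRMax m xs p′)

moveAll-preserves-LTRMax : ∀ ms {v} xs → LTRMax v xs → LTRMax v (moveAll ms xs)
moveAll-preserves-LTRMax []       xs p = p
moveAll-preserves-LTRMax (m ∷ ms) xs p =
  moveAll-preserves-LTRMax ms (moveRight m xs) (moveRight-preserves-LTRMax m xs p)

proposition3p1 : (n : ℕ) (π σ : List ℕ) → IsPerm n σ → IsPerm n π → π ≡ q σ →
    (v : ℕ) → IsLTRMaxValue σ v → IsLTRMaxValue π v
proposition3p1 _ π σ _ _ refl v maxσ =
  LTRMax⇒IsLTRMaxValue
    (moveAll-preserves-LTRMax (reverse (ltrMaxima σ)) σ (IsLTRMaxValue⇒LTRMax σ maxσ))
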